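{- Let $(\mathcal{E},\mathcal{S})$ be a category with display maps. If $\mathcal{S}$ satisfies (F), then so does the class $\mathcal{S}^{\mathrm{cov}}$ of morphisms covered by a morphism in $\mathcal{S}$.
   Context: Cover: $f=mg$, $m$ mono $\Rightarrow m$ iso. Positive Heyting category: finite limits, stable (cover, mono)-factorisations, disjoint stable finite coproducts, right adjoints $\forall_f$ to pullback of subobjects. A commutative square with top $A\to B$, left $f:A\to C$, right $g:B\to D$, bottom $p:C\to D$ is a covering square if $p$ is a cover and $A\to C\times_DB$ is a cover; then $f$ covers $g$. Class of display maps $\mathcal{S}$: pullback stable; closed under sums $X+X'\to Y+Y'$ of maps and under composition; contains $0\to1,1\to1,1+1\to1$ and all diagonals; Collection (for a cover $p:Y\to X$ and $f:X\to A\in\mathcal{S}$ there is a covering square with left side in $\mathcal{S}$, top factoring through $p$, right side $f$); for $f\in\mathcal{S}$, $\forall_f$ preserves subobjects represented by monos in $\mathcal{S}$; and Images (if $m\circ e\in\mathcal{S}$ with $e$ a cover and $m$ mono then $m\in\mathcal{S}$). Axiom (F) for a class $\mathcal{T}$: for any $\phi:B\to A$ in $\mathcal{T}$ together with a map $A\to X$ in $\mathcal{T}$, there are a cover $q:X'\to X$, a map $y:Y\to X'$ in $\mathcal{T}$ and a displayed mvs $P$ of $\phi$ over $Y$ such that for every map $z:Z\to X'$ and every displayed mvs $Q$ of $\phi$ over $Z$ there exist $k:U\to Y$ and a cover $l:U\to Z$ with $yk=zl$ and $k^*P\le l^*Q$ as mvs's of $\phi$ over $U$. For a map $W\to X$,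 a mvs of $\phi$ over $W$ is a subobject $P$ of the pullback $B_W$ of $B$ along $W\to X$ with $P\to A_W$ a cover; displayed if $P\to A_W\in\mathcal{T}$. -}

module Defs where

open import Level using (Level; _⊔_) renaming (suc to lsuc)
open import Data.Product using (Σ; Σ-syntax; _×_; _,_; proj₁; proj₂)
open import Relation.Binary using (Rel; IsEquivalence)

record Category (o ℓ e : Level) : Set (lsuc (o ⊔ ℓ ⊔ e)) where
  infixr 9 _∘_
  infix  4 _≈_
  infix  5 _⇒_
  field
    Obj       : Set o
    _⇒_       : Obj → Obj → Set ℓ
    _≈_       : ∀ {A B} → Rel (A ⇒ B) e
    id        : ∀ {A} → A ⇒ A
    _∘_       : ∀ {A B C} → B ⇒ C → A ⇒ B → A ⇒ C
    equiv     : ∀ {A B} → IsEquivalence (_≈_ {A} {B})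
    ∘-resp-≈  : ∀ {A B C} {f h : B ⇒ C} {g i : A ⇒ B} → f ≈ h → g ≈ i → f ∘ g ≈ h ∘ i
    assoc     : ∀ {A B C D} {f : A ⇒ B} {g : B ⇒ C} {h : C ⇒ D} →
                (h ∘ g) ∘ f ≈ h ∘ (g ∘ f)
    identityˡ : ∀ {A B} {f : A ⇒ B} → id ∘ f ≈ f
    identityʳ : ∀ {A B} {f : A ⇒ B} → f ∘ id ≈ f

  module _ {A B : Obj} where
    open IsEquivalence (equiv {A} {B}) public
      renaming (refl to ≈-refl; sym to ≈-sym; trans to ≈-trans)

module Notions {o ℓ e} (𝒞 : Category o ℓ e) where
  open Category 𝒞

  MorClass : (s : Level) → Set (o ⊔ ℓ ⊔ lsuc s)
  MorClass s = ∀ {A B : Obj} → A ⇒ B → Set s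

  Mono : ∀ {A B} → A ⇒ B → Set (o ⊔ ℓ ⊔ e)
  Mono {A} f = ∀ {Z} (g h : Z ⇒ A) → f ∘ g ≈ f ∘ h → g ≈ h

  record Iso {A B} (f : A ⇒ B) : Set (ℓ ⊔ e) where
    field
      inv  : B ⇒ A
      isoˡ : inv ∘ f ≈ id
      isoʳ : f ∘ inv ≈ id

  Cover : ∀ {A B} → A ⇒ B → Set (o ⊔ ℓ ⊔ e)
  Cover {A} {B} f = ∀ {M} (g : A ⇒ M) (m : M ⇒ B) → Mono m → f ≈ m ∘ g → Iso m

  record IsPullback {P A B C} (f : A ⇒ C) (g : B ⇒ C) (p₁ : P ⇒ A) (p₂ : P ⇒ B)
         : Set (o ⊔ ℓ ⊔ e) where
    field
      commute   : f ∘ p₁ ≈ g ∘ p₂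
      universal : ∀ {Z} (h₁ : Z ⇒ A) (h₂ : Z ⇒ B) → f ∘ h₁ ≈ g ∘ h₂ → Z ⇒ P
      p₁∘universal : ∀ {Z} {h₁ : Z ⇒ A} {h₂ : Z ⇒ B} (eq : f ∘ h₁ ≈ g ∘ h₂) →
                     p₁ ∘ universal h₁ h₂ eq ≈ h₁
      p₂∘universal : ∀ {Z} {h₁ : Z ⇒ A} {h₂ : Z ⇒ B} (eq : f ∘ h₁ ≈ g ∘ h₂) →
                     p₂ ∘ universal h₁ h₂ eq ≈ h₂
      unique    : ∀ {Z} {h₁ : Z ⇒ A} {h₂ : Z ⇒ B} (eq : f ∘ h₁ ≈ g ∘ h₂) (u : Z ⇒ P) →
                  p₁ ∘ u ≈ h₁ → p₂ ∘ u ≈ h₂ → u ≈ universal h₁ h₂ eq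

  record Pullback {A B C} (f : A ⇒ C) (g : B ⇒ C) : Set (o ⊔ ℓ ⊔ e) where
    field
      P          : Obj
      p₁         : P ⇒ A
      p₂         : P ⇒ B
      isPullback : IsPullback f g p₁ p₂
    open IsPullback isPullback public

  IsTerminal : Obj → Set (o ⊔ ℓ ⊔ e)
  IsTerminal T = ∀ X → Σ[ ! ∈ X ⇒ T ] (∀ (g : X ⇒ T) → g ≈ !)

  IsInitial : Obj → Set (o ⊔ ℓ ⊔ e)
  IsInitial I = ∀ X → Σ[ ! ∈ I ⇒ X ] (∀ (g : I ⇒ X) → g ≈ !)

  IsCoproduct : ∀ {A B S} → A ⇒ S → B ⇒ S → Set (o ⊔ ℓ ⊔ e)
  IsCoproduct {A} {B} {S} i₁ i₂ =
    ∀ {Z} (f : A ⇒ Z) (g : B ⇒ Z) →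
      Σ[ u ∈ S ⇒ Z ] ((u ∘ i₁ ≈ f) × (u ∘ i₂ ≈ g) ×
                      (∀ (v : S ⇒ Z) → v ∘ i₁ ≈ f → v ∘ i₂ ≈ g → v ≈ u))

  record Sub (X : Obj) : Set (o ⊔ ℓ ⊔ e) where
    field
      dom  : Obj
      arr  : dom ⇒ X
      mono : Mono arr
  open Sub public

  _≤ₘ_ : ∀ {X M N} → M ⇒ X → N ⇒ X → Set (ℓ ⊔ e)
  _≤ₘ_ {M = M} {N} m n = Σ[ h ∈ M ⇒ N ] (n ∘ h ≈ m)

  _≤_ : ∀ {X} → Sub X → Sub X → Set (ℓ ⊔ e)
  P ≤ Q = arr P ≤ₘ arr Q

record PositiveHeyting {o ℓ e} (𝒞 : Category o ℓ e) : Set (o ⊔ ℓ ⊔ e) where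
  open Category 𝒞
  open Notions 𝒞
  field
    𝟏          : Obj
    𝟏-terminal : IsTerminal 𝟏
    pullback   : ∀ {A B C} (f : A ⇒ C) (g : B ⇒ C) → Pullback f g
    factor      : ∀ {A B} (f : A ⇒ B) →
                  Σ[ M ∈ Obj ] Σ[ c ∈ A ⇒ M ] Σ[ m ∈ M ⇒ B ]
                    (Cover c × Mono m × (f ≈ m ∘ c))
    cover-stable : ∀ {P A B C} {f : A ⇒ C} {g : B ⇒ C} {p₁ : P ⇒ A} {p₂ : P ⇒ B} →
                   IsPullback f g p₁ p₂ → Cover g → Cover p₁
    𝟎           : Obj
    𝟎-initial   : IsInitial 𝟎
    𝟎-stable    : ∀ {Y} → Y ⇒ 𝟎 → IsInitial Y
    _+_         : Obj → Obj → Obj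
    inl         : ∀ {A B} → A ⇒ A + B
    inr         : ∀ {A B} → B ⇒ A + B
    +-coproduct : ∀ {A B} → IsCoproduct (inl {A} {B}) inr
    inl-mono    : ∀ {A B} → Mono (inl {A} {B})
    inr-mono    : ∀ {A B} → Mono (inr {A} {B})
    disjoint    : ∀ {A B P} {p₁ : P ⇒ A} {p₂ : P ⇒ B} →
                  IsPullback (inl {A} {B}) inr p₁ p₂ → IsInitial P
    +-stable    : ∀ {A B Z P₁ P₂} (h : Z ⇒ A + B)
                  {p₁ : P₁ ⇒ Z} {q₁ : P₁ ⇒ A} {p₂ : P₂ ⇒ Z} {q₂ : P₂ ⇒ B} →
                  IsPullback h inl p₁ q₁ → IsPullback h inr p₂ q₂ →
                  IsCoproduct p₁ p₂
    ∀[_]      : ∀ {X Y} (f : X ⇒ Y) → Sub X → Sub Y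
    ∀-adjoint : ∀ {X Y} (f : X ⇒ Y) (P : Sub X) (Q : Sub Y) →
                let module PB = Pullback (pullback (arr Q) f) in
                ((PB.p₂ ≤ₘ arr P) → (arr Q ≤ₘ arr (∀[ f ] P))) ×
                ((arr Q ≤ₘ arr (∀[ f ] P)) → (PB.p₂ ≤ₘ arr P))

module InPH {o ℓ e} (𝒞 : Category o ℓ e) (H : PositiveHeyting 𝒞) where
  open Category 𝒞
  open Notions 𝒞
  open PositiveHeyting H

  ⟨_,_⟩[_] : ∀ {Z A B C} {f : A ⇒ C} {g : B ⇒ C} (h₁ : Z ⇒ A) (h₂ : Z ⇒ B) →
             f ∘ h₁ ≈ g ∘ h₂ → Z ⇒ Pullback.P (pullback f g)
  ⟨_,_⟩[_] {f = f} {g} h₁ h₂ eq = Pullback.universal (pullback f g) h₁ h₂ eq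

  _* : ∀ {X Y M} (f : Y ⇒ X) (m : M ⇒ X) → Pullback.P (pullback m f) ⇒ Y
  (f *) m = Pullback.p₂ (pullback m f)

  !ₜ : ∀ {X} → X ⇒ 𝟏
  !ₜ {X} = proj₁ (𝟏-terminal X)

  ¡ : ∀ {X} → 𝟎 ⇒ X
  ¡ {X} = proj₁ (𝟎-initial X)

  _×ₒ_ : Obj → Obj → Obj
  A ×ₒ B = Pullback.P (pullback (!ₜ {A}) (!ₜ {B}))

  Δ : ∀ {X} → X ⇒ X ×ₒ X
  Δ {X} = ⟨ id , id ⟩[ ≈-refl ]

  [_,_] : ∀ {A B Z} → A ⇒ Z → B ⇒ Z → A + B ⇒ Z
  [ f , g ] = proj₁ (+-coproduct f g)

  _⊕_ : ∀ {X Y X' Y'} → X ⇒ Y → X' ⇒ Y' → X + X' ⇒ Y + Y'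
  f ⊕ f' = [ inl ∘ f , inr ∘ f' ]

  CoveringSquare : ∀ {A B C D} (t : A ⇒ B) (f : A ⇒ C) (g : B ⇒ D) (p : C ⇒ D) →
                   Set (o ⊔ ℓ ⊔ e)
  CoveringSquare t f g p =
    Σ[ sq ∈ p ∘ f ≈ g ∘ t ] (Cover p × Cover (⟨ f , t ⟩[ sq ]))

  _covers_ : ∀ {A B C D} (f : A ⇒ C) (g : B ⇒ D) → Set (o ⊔ ℓ ⊔ e)
  _covers_ {A} {B} {C} {D} f g =
    Σ[ t ∈ A ⇒ B ] Σ[ p ∈ C ⇒ D ] CoveringSquare t f g p

  Cov : ∀ {s} → MorClass s → MorClass (o ⊔ ℓ ⊔ e ⊔ s)
  Cov 𝒮 {B} {D} g = Σ[ A ∈ Obj ] Σ[ C ∈ Obj ] Σ[ f ∈ A ⇒ C ] (𝒮 f × f covers g)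

  module MVS {B A X : Obj} (φ : B ⇒ A) (a : A ⇒ X) where
    A[_] : ∀ {W} → W ⇒ X → Obj
    A[ w ] = Pullback.P (pullback a w)

    B[_] : ∀ {W} → W ⇒ X → Obj
    B[ w ] = Pullback.P (pullback (a ∘ φ) w)

    φ[_] : ∀ {W} (w : W ⇒ X) → B[ w ] ⇒ A[ w ]
    φ[ w ] = ⟨ φ ∘ PB.p₁ , PB.p₂ ⟩[ ≈-trans (≈-sym assoc) PB.commute ]
      where module PB = Pullback (pullback (a ∘ φ) w)

    record DMVS {s} (𝒯 : MorClass s) {W} (w : W ⇒ X) : Set (o ⊔ ℓ ⊔ e ⊔ s) where
      field
        sub       : Sub B[ w ]
        cover     : Cover (φ[ w ] ∘ arr sub)
        displayed : 𝒯 (φ[ w ] ∘ arr sub)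
    open DMVS public

    reindex : ∀ {U W} {u : U ⇒ X} {w : W ⇒ X} (k : U ⇒ W) → w ∘ k ≈ u →
              B[ u ] ⇒ B[ w ]
    reindex {u = u} {w} k eq =
      ⟨ PU.p₁ , k ∘ PU.p₂ ⟩[ ≈-trans PU.commute
                               (≈-trans (∘-resp-≈ (≈-sym eq) ≈-refl) assoc) ]
      where module PU = Pullback (pullback (a ∘ φ) u)

  AxiomF : ∀ {s} → MorClass s → Set (o ⊔ ℓ ⊔ e ⊔ s)
  AxiomF 𝒯 =
    ∀ {B A X} (φ : B ⇒ A) (a : A ⇒ X) → 𝒯 φ → 𝒯 a →
    Σ[ X' ∈ Obj ] Σ[ q ∈ X' ⇒ X ] Σ[ Y ∈ Obj ] Σ[ y ∈ Y ⇒ X' ]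
    Σ[ P ∈ MVS.DMVS φ a 𝒯 (q ∘ y) ]
      (Cover q × 𝒯 y ×
       (∀ {Z} (z : Z ⇒ X') (Q : MVS.DMVS φ a 𝒯 (q ∘ z)) →
        Σ[ U ∈ Obj ] Σ[ k ∈ U ⇒ Y ] Σ[ l ∈ U ⇒ Z ]
        Σ[ eq ∈ y ∘ k ≈ z ∘ l ]
          (Cover l ×
           -- k*P ≤ l*Q as subobjects of B_U, where U lies over X via q ∘ (y ∘ k)
           ((MVS.reindex φ a k assoc *) (arr (MVS.DMVS.sub P)) ≤ₘ
            (MVS.reindex φ a l
               (≈-trans assoc (∘-resp-≈ ≈-refl (≈-sym eq))) *) (arr (MVS.DMVS.sub Q))))))

  record DisplayMaps (s : Level) : Set (o ⊔ ℓ ⊔ e ⊔ lsuc s) where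
    field
      𝒮 : MorClass s
      pullback-stable : ∀ {P A B C} {f : A ⇒ C} {g : B ⇒ C} {p₁ : P ⇒ A} {p₂ : P ⇒ B} →
                        IsPullback f g p₁ p₂ → 𝒮 g → 𝒮 p₁
      sums        : ∀ {X Y X' Y'} {f : X ⇒ Y} {f' : X' ⇒ Y'} → 𝒮 f → 𝒮 f' → 𝒮 (f ⊕ f')
      composition : ∀ {A B C} {f : A ⇒ B} {g : B ⇒ C} → 𝒮 f → 𝒮 g → 𝒮 (g ∘ f)
      𝟎→𝟏         : 𝒮 (¡ {𝟏})
      𝟏→𝟏         : 𝒮 (id {𝟏})
      𝟏+𝟏→𝟏       : 𝒮 (!ₜ {𝟏 + 𝟏})
      diagonals   : ∀ {X} → 𝒮 (Δ {X})
      collection  : ∀ {Y X A} (p : Y ⇒ X) (f : X ⇒ A) → Cover p → 𝒮 f →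
                    Σ[ B ∈ Obj ] Σ[ C ∈ Obj ] Σ[ g ∈ B ⇒ C ] Σ[ t ∈ B ⇒ Y ]
                    Σ[ r ∈ C ⇒ A ]
                      (𝒮 g × CoveringSquare (p ∘ t) g f r)
      ∀-display   : ∀ {X Y} (f : X ⇒ Y) (P : Sub X) → 𝒮 f → 𝒮 (arr P) →
                    𝒮 (arr (∀[ f ] P))
      images      : ∀ {A M B} {e : A ⇒ M} {m : M ⇒ B} → Cover e → Mono m →
                    𝒮 (m ∘ e) → 𝒮 m

-- By Collection, the two covering squares exhibiting φ and a as members of 𝒮^cov can be
-- refined to a composable pair φ₀ : B₀ → A₀, a₀ : A₀ → X₀ in 𝒮 that maps onto (φ, a)
-- by squares whose comparison maps into the pullbacks are covers, over a cover X₀ → X.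
-- Apply (F) to (φ₀, a₀). Over a common base, the map B₀ → B pushes an mvs P₀ of φ₀
-- forward to its image P, an mvs of φ displayed in 𝒮^cov. Conversely an mvs Q of φ
-- displayed in 𝒮^cov pulls back along B₀ → B and, after a second use of Collection and
-- an image factorisation, yields an mvs Q₀ of φ₀ displayed in 𝒮 whose push-forward lies
-- in Q. Hence the weak initiality of P₀ against Q₀ gives that of P against Q.

module Submission where

open import Level using (_⊔_)
open import Defs
open import Data.Product using (Σ; Σ-syntax; _×_; _,_; proj₁; proj₂)
open import Relation.Binary using (Setoid)
import Relation.Binary.Reasoning.Setoid as SetoidReasoning

module CategoryLemmas {o ℓ e} (𝒞 : Category o ℓ e) where
  open Category 𝒞
  open Notions 𝒞

  hom : Obj → Obj → Setoid ℓ e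
  hom A B = record { Carrier = A ⇒ B ; _≈_ = _≈_ ; isEquivalence = equiv }

  module HomReasoning {A B : Obj} = SetoidReasoning (hom A B)
  open HomReasoning public

  infixr 4 _⟩∘⟨_ refl⟩∘⟨_
  infixl 5 _⟩∘⟨refl

  _⟩∘⟨_ : ∀ {A B C} {f h : B ⇒ C} {g i : A ⇒ B} → f ≈ h → g ≈ i → f ∘ g ≈ h ∘ i
  _⟩∘⟨_ = ∘-resp-≈

  refl⟩∘⟨_ : ∀ {A B C} {f : B ⇒ C} {g i : A ⇒ B} → g ≈ i → f ∘ g ≈ f ∘ i
  refl⟩∘⟨ p = ∘-resp-≈ ≈-refl p

  _⟩∘⟨refl : ∀ {A B C} {f h : B ⇒ C} {g : A ⇒ B} → f ≈ h → f ∘ g ≈ h ∘ g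
  p ⟩∘⟨refl = ∘-resp-≈ p ≈-refl

  sym-assoc : ∀ {A B C D} {f : A ⇒ B} {g : B ⇒ C} {h : C ⇒ D} → h ∘ (g ∘ f) ≈ (h ∘ g) ∘ f
  sym-assoc = ≈-sym assoc

  pullˡ : ∀ {A B C D} {f : B ⇒ C} {g : C ⇒ D} {k : B ⇒ D} {x : A ⇒ B} →
          g ∘ f ≈ k → g ∘ (f ∘ x) ≈ k ∘ x
  pullˡ p = ≈-trans sym-assoc (p ⟩∘⟨refl)

  pushˡ : ∀ {A B C D} {f : B ⇒ C} {g : C ⇒ D} {k : B ⇒ D} {x : A ⇒ B} →
          k ≈ g ∘ f → k ∘ x ≈ g ∘ (f ∘ x)
  pushˡ p = ≈-sym (pullˡ (≈-sym p))

  module IsPullbackProps {P A B C} {f : A ⇒ C} {g : B ⇒ C} {p₁ : P ⇒ A} {p₂ : P ⇒ B}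
         (ip : IsPullback f g p₁ p₂) where
    open IsPullback ip public

    commute∘ : ∀ {Z} {x : Z ⇒ P} → f ∘ (p₁ ∘ x) ≈ g ∘ (p₂ ∘ x)
    commute∘ = ≈-trans sym-assoc (≈-trans (commute ⟩∘⟨refl) assoc)

    unique-diagram : ∀ {Z} {x y : Z ⇒ P} → p₁ ∘ x ≈ p₁ ∘ y → p₂ ∘ x ≈ p₂ ∘ y → x ≈ y
    unique-diagram {x = x} {y} eq₁ eq₂ =
      ≈-trans (unique commute∘ x ≈-refl ≈-refl)
              (≈-sym (unique commute∘ y (≈-sym eq₁) (≈-sym eq₂)))

    p₁∘universal∘ : ∀ {Y Z} {h₁ : Z ⇒ A} {h₂ : Z ⇒ B} (eq : f ∘ h₁ ≈ g ∘ h₂) {x : Y ⇒ Z} →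
                    p₁ ∘ (universal h₁ h₂ eq ∘ x) ≈ h₁ ∘ x
    p₁∘universal∘ eq = pullˡ (p₁∘universal eq)

    p₂∘universal∘ : ∀ {Y Z} {h₁ : Z ⇒ A} {h₂ : Z ⇒ B} (eq : f ∘ h₁ ≈ g ∘ h₂) {x : Y ⇒ Z} →
                    p₂ ∘ (universal h₁ h₂ eq ∘ x) ≈ h₂ ∘ x
    p₂∘universal∘ eq = pullˡ (p₂∘universal eq)

  module PullbackProps {A B C} {f : A ⇒ C} {g : B ⇒ C} (PB : Pullback f g) where
    open Pullback PB public using (P; p₁; p₂; isPullback)
    open IsPullbackProps isPullback public

  mkIsPullback : ∀ {P A B C} {f : A ⇒ C} {g : B ⇒ C} {p₁ : P ⇒ A} {p₂ : P ⇒ B} →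
    f ∘ p₁ ≈ g ∘ p₂ →
    (∀ {Z} {x y : Z ⇒ P} → p₁ ∘ x ≈ p₁ ∘ y → p₂ ∘ x ≈ p₂ ∘ y → x ≈ y) →
    (u : ∀ {Z} (h₁ : Z ⇒ A) (h₂ : Z ⇒ B) → f ∘ h₁ ≈ g ∘ h₂ → Z ⇒ P) →
    (∀ {Z} {h₁ : Z ⇒ A} {h₂ : Z ⇒ B} (eq : f ∘ h₁ ≈ g ∘ h₂) → p₁ ∘ u h₁ h₂ eq ≈ h₁) →
    (∀ {Z} {h₁ : Z ⇒ A} {h₂ : Z ⇒ B} (eq : f ∘ h₁ ≈ g ∘ h₂) → p₂ ∘ u h₁ h₂ eq ≈ h₂) →
    IsPullback f g p₁ p₂
  mkIsPullback commute jointly-monic u p₁∘u p₂∘u = record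
    { commute = commute ; universal = u ; p₁∘universal = p₁∘u ; p₂∘universal = p₂∘u
    ; unique = λ eq v p₁∘v p₂∘v →
        jointly-monic (≈-trans p₁∘v (≈-sym (p₁∘u eq))) (≈-trans p₂∘v (≈-sym (p₂∘u eq))) }

  IsPullback-swap : ∀ {P A B C} {f : A ⇒ C} {g : B ⇒ C} {p₁ : P ⇒ A} {p₂ : P ⇒ B} →
                    IsPullback f g p₁ p₂ → IsPullback g f p₂ p₁
  IsPullback-swap ip = mkIsPullback (≈-sym commute) (λ eq₁ eq₂ → unique-diagram eq₂ eq₁)
    (λ h₁ h₂ eq → universal h₂ h₁ (≈-sym eq))
    (λ eq → p₂∘universal (≈-sym eq)) (λ eq → p₁∘universal (≈-sym eq))
    where open IsPullbackProps ip

  IsPullback-resp-≈ : ∀ {P A B C} {f f' : A ⇒ C} {g g' : B ⇒ C} {p₁ : P ⇒ A} {p₂ : P ⇒ B} →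
                      f ≈ f' → g ≈ g' → IsPullback f g p₁ p₂ → IsPullback f' g' p₁ p₂
  IsPullback-resp-≈ {f = f} {f'} {g} {g'} f≈f' g≈g' ip = mkIsPullback
    (≈-trans (≈-sym f≈f' ⟩∘⟨refl) (≈-trans commute (g≈g' ⟩∘⟨refl))) unique-diagram
    (λ h₁ h₂ eq → universal h₁ h₂ (resp eq)) (λ eq → p₁∘universal (resp eq))
    (λ eq → p₂∘universal (resp eq))
    where
      open IsPullbackProps ip
      resp : ∀ {Z} {h₁ : Z ⇒ _} {h₂ : Z ⇒ _} → f' ∘ h₁ ≈ g' ∘ h₂ → f ∘ h₁ ≈ g ∘ h₂
      resp eq = ≈-trans (f≈f' ⟩∘⟨refl) (≈-trans eq (≈-sym g≈g' ⟩∘⟨refl))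

  IsPullback-id : ∀ {A C} {f f' : A ⇒ C} → f ≈ f' → IsPullback id f' f id
  IsPullback-id f≈f' = mkIsPullback (≈-trans identityˡ (≈-trans f≈f' (≈-sym identityʳ)))
    (λ _ eq₂ → ≈-trans (≈-sym identityˡ) (≈-trans eq₂ identityˡ))
    (λ _ h₂ _ → h₂)
    (λ eq → ≈-trans (f≈f' ⟩∘⟨refl) (≈-trans (≈-sym eq) identityˡ))
    (λ _ → identityˡ)

  IsPullback-paste : ∀ {P Q A B C D} {f : A ⇒ C} {g : B ⇒ C} {p₁ : P ⇒ A} {p₂ : P ⇒ B}
                       {h : D ⇒ A} {q₁ : Q ⇒ D} {r : Q ⇒ P} →
                     IsPullback f g p₁ p₂ → IsPullback h p₁ q₁ r →
                     IsPullback (f ∘ h) g q₁ (p₂ ∘ r)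
  IsPullback-paste {f = f} {g} {p₁} {p₂} {h} {q₁} {r} right left = mkIsPullback
    (begin
      (f ∘ h) ∘ q₁   ≈⟨ assoc ⟩
      f ∘ (h ∘ q₁)   ≈⟨ refl⟩∘⟨ L.commute ⟩
      f ∘ (p₁ ∘ r)   ≈⟨ R.commute∘ ⟩
      g ∘ (p₂ ∘ r)   ∎)
    (λ eq₁ eq₂ → L.unique-diagram eq₁
      (R.unique-diagram (≈-trans (≈-sym L.commute∘) (≈-trans (refl⟩∘⟨ eq₁) L.commute∘))
                        (≈-trans sym-assoc (≈-trans eq₂ assoc))))
    (λ h₁ h₂ eq → L.universal h₁ (middle eq) (≈-sym (R.p₁∘universal (assoc-eq eq))))
    (λ eq → L.p₁∘universal _)
    (λ eq → ≈-trans assoc (≈-trans (refl⟩∘⟨ L.p₂∘universal _) (R.p₂∘universal _)))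
    where
      module R = IsPullbackProps right
      module L = IsPullbackProps left
      assoc-eq : ∀ {Z} {h₁ : Z ⇒ _} {h₂ : Z ⇒ _} → (f ∘ h) ∘ h₁ ≈ g ∘ h₂ → f ∘ (h ∘ h₁) ≈ g ∘ h₂
      assoc-eq eq = ≈-trans sym-assoc eq
      middle : ∀ {Z} {h₁ : Z ⇒ _} {h₂ : Z ⇒ _} → (f ∘ h) ∘ h₁ ≈ g ∘ h₂ → Z ⇒ _
      middle {h₁ = h₁} {h₂} eq = R.universal (h ∘ h₁) h₂ (assoc-eq eq)

  IsPullback-unpaste : ∀ {P Q A B C D} {f : A ⇒ C} {g : B ⇒ C} {p₁ : P ⇒ A} {p₂ : P ⇒ B}
                         {h : D ⇒ A} {q₁ : Q ⇒ D} {q₂ : Q ⇒ B} {r : Q ⇒ P} →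
                       IsPullback f g p₁ p₂ → IsPullback (f ∘ h) g q₁ q₂ →
                       p₁ ∘ r ≈ h ∘ q₁ → p₂ ∘ r ≈ q₂ → IsPullback h p₁ q₁ r
  IsPullback-unpaste {P} {f = f} {g} {p₁} {p₂} {h} {q₁} {q₂} {r} right outer p₁r p₂r = mkIsPullback
    (≈-sym p₁r)
    (λ {_} {x} {y} eq₁ eq₂ → O.unique-diagram eq₁ (begin
      q₂ ∘ x         ≈⟨ pushˡ (≈-sym p₂r) ⟩
      p₂ ∘ (r ∘ x)   ≈⟨ refl⟩∘⟨ eq₂ ⟩
      p₂ ∘ (r ∘ y)   ≈⟨ pullˡ p₂r ⟩
      q₂ ∘ y         ∎))
    (λ h₁ h₂ eq → O.universal h₁ (p₂ ∘ h₂) (outer-eq eq))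
    (λ eq → O.p₁∘universal (outer-eq eq))
    (λ {_} {h₁} {h₂} eq → R.unique-diagram
      (begin
        p₁ ∘ (r ∘ _)   ≈⟨ pullˡ p₁r ⟩
        (h ∘ q₁) ∘ _   ≈⟨ assoc ⟩
        h ∘ (q₁ ∘ _)   ≈⟨ refl⟩∘⟨ O.p₁∘universal (outer-eq eq) ⟩
        h ∘ h₁         ≈⟨ eq ⟩
        p₁ ∘ h₂        ∎)
      (≈-trans (pullˡ p₂r) (O.p₂∘universal (outer-eq eq))))
    where
      module R = IsPullbackProps right
      module O = IsPullbackProps outer
      outer-eq : ∀ {Z} {h₁ : Z ⇒ _} {h₂ : Z ⇒ P} → h ∘ h₁ ≈ p₁ ∘ h₂ →
                 (f ∘ h) ∘ h₁ ≈ g ∘ (p₂ ∘ h₂)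
      outer-eq {h₁ = h₁} {h₂} eq = begin
        (f ∘ h) ∘ h₁   ≈⟨ assoc ⟩
        f ∘ (h ∘ h₁)   ≈⟨ refl⟩∘⟨ eq ⟩
        f ∘ (p₁ ∘ h₂)  ≈⟨ R.commute∘ ⟩
        g ∘ (p₂ ∘ h₂)  ∎

  IsPullback-Iso : ∀ {P Q A B C} {f f' : A ⇒ C} {g g' : B ⇒ C}
                     {p₁ : P ⇒ A} {p₂ : P ⇒ B} {q₁ : Q ⇒ A} {q₂ : Q ⇒ B} →
                   IsPullback f g p₁ p₂ → IsPullback f' g' q₁ q₂ → f ≈ f' → g ≈ g' →
                   (c : P ⇒ Q) → q₁ ∘ c ≈ p₁ → q₂ ∘ c ≈ p₂ → Iso c
  IsPullback-Iso {P} {Q} {f = f} {f'} {g} {g'} {p₁} {p₂} {q₁} {q₂} ip iq f≈f' g≈g' c q₁c q₂c = record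
    { inv  = d
    ; isoˡ = I.unique-diagram (≈-trans (pullˡ (I.p₁∘universal eq)) (≈-trans q₁c (≈-sym identityʳ)))
                              (≈-trans (pullˡ (I.p₂∘universal eq)) (≈-trans q₂c (≈-sym identityʳ)))
    ; isoʳ = J.unique-diagram (≈-trans (pullˡ q₁c) (≈-trans (I.p₁∘universal eq) (≈-sym identityʳ)))
                              (≈-trans (pullˡ q₂c) (≈-trans (I.p₂∘universal eq) (≈-sym identityʳ)))
    }
    where
      module I = IsPullbackProps ip
      module J = IsPullbackProps iq
      eq : f ∘ q₁ ≈ g ∘ q₂
      eq = ≈-trans (f≈f' ⟩∘⟨refl) (≈-trans J.commute (≈-sym g≈g' ⟩∘⟨refl))
      d : Q ⇒ P
      d = I.universal q₁ q₂ eq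

  Mono-pullback : ∀ {P A B C} {f : A ⇒ C} {g : B ⇒ C} {p₁ : P ⇒ A} {p₂ : P ⇒ B} →
                  IsPullback f g p₁ p₂ → Mono f → Mono p₂
  Mono-pullback {f = f} {g} {p₁} {p₂} ip f-mono x y eq =
    P.unique-diagram (f-mono _ _ (≈-trans P.commute∘ (≈-trans (refl⟩∘⟨ eq) (≈-sym P.commute∘)))) eq
    where module P = IsPullbackProps ip

  Cover-resp-≈ : ∀ {A B} {f f' : A ⇒ B} → f ≈ f' → Cover f → Cover f'
  Cover-resp-≈ f≈f' f-cover g m m-mono eq = f-cover g m m-mono (≈-trans f≈f' eq)

  Iso⇒Cover : ∀ {A B} {f : A ⇒ B} → Iso f → Cover f
  Iso⇒Cover {f = f} f-iso g m m-mono eq = record { inv = g ∘ inv ; isoˡ = isoˡ′ ; isoʳ = isoʳ′ }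
    where
      open Iso f-iso
      isoʳ′ : m ∘ (g ∘ inv) ≈ id
      isoʳ′ = ≈-trans sym-assoc (≈-trans (≈-sym eq ⟩∘⟨refl) isoʳ)
      isoˡ′ : (g ∘ inv) ∘ m ≈ id
      isoˡ′ = m-mono _ _ (begin
        m ∘ ((g ∘ inv) ∘ m)   ≈⟨ sym-assoc ⟩
        (m ∘ (g ∘ inv)) ∘ m   ≈⟨ isoʳ′ ⟩∘⟨refl ⟩
        id ∘ m                ≈⟨ identityˡ ⟩
        m                     ≈⟨ ≈-sym identityʳ ⟩
        m ∘ id                ∎)

  Cover-factorˡ : ∀ {A B C} {f : A ⇒ B} {g : B ⇒ C} → Cover (g ∘ f) → Cover g
  Cover-factorˡ {f = f} gf-cover h m m-mono eq = gf-cover (h ∘ f) m m-mono (pushˡ eq)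

module RegularLemmas {o ℓ e} (𝒞 : Category o ℓ e) (H : PositiveHeyting 𝒞) where
  open Category 𝒞
  open Notions 𝒞
  open PositiveHeyting H
  open InPH 𝒞 H
  open CategoryLemmas 𝒞

  Cover-∘ : ∀ {A B C} {f : A ⇒ B} {g : B ⇒ C} → Cover f → Cover g → Cover (g ∘ f)
  Cover-∘ {f = f} {g} f-cover g-cover h m m-mono eq =
    g-cover (PB.p₁ ∘ inv) m m-mono (begin
      g                  ≈⟨ ≈-sym identityʳ ⟩
      g ∘ id             ≈⟨ refl⟩∘⟨ ≈-sym isoʳ ⟩
      g ∘ (PB.p₂ ∘ inv)  ≈⟨ ≈-sym PB.commute∘ ⟩
      m ∘ (PB.p₁ ∘ inv)  ∎)
    where
      module PB = PullbackProps (pullback m g)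
      open Iso (f-cover (PB.universal h f (≈-sym eq)) PB.p₂
                        (Mono-pullback PB.isPullback m-mono) (≈-sym (PB.p₂∘universal _)))

  cover-mono-lift : ∀ {S T M N} {c : S ⇒ T} {n : N ⇒ M} {h : T ⇒ M} {v : S ⇒ N} →
                    Cover c → Mono n → n ∘ v ≈ h ∘ c → h ≤ₘ n
  cover-mono-lift {c = c} {n} {h} {v} c-cover n-mono eq = PB.p₁ ∘ inv , (begin
    n ∘ (PB.p₁ ∘ inv)  ≈⟨ PB.commute∘ ⟩
    h ∘ (PB.p₂ ∘ inv)  ≈⟨ refl⟩∘⟨ isoʳ ⟩
    h ∘ id             ≈⟨ identityʳ ⟩
    h                  ∎)
    where
      module PB = PullbackProps (pullback n h)
      open Iso (c-cover (PB.universal v c eq) PB.p₂ (Mono-pullback PB.isPullback n-mono)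
                        (≈-sym (PB.p₂∘universal eq)))

  id-Iso : ∀ {A} → Iso (id {A})
  id-Iso = record { inv = id ; isoˡ = identityˡ ; isoʳ = identityˡ }

  QuasiPullback : ∀ {A B C D} (t : A ⇒ B) (f : A ⇒ C) (g : B ⇒ D) (p : C ⇒ D) → Set (o ⊔ ℓ ⊔ e)
  QuasiPullback t f g p = Σ[ sq ∈ p ∘ f ≈ g ∘ t ] Cover ⟨ f , t ⟩[ sq ]

  module _ {A B C D} {t : A ⇒ B} {f : A ⇒ C} {g : B ⇒ D} {p : C ⇒ D} where
    private module O = PullbackProps (pullback p g)

    QuasiPullback⇒Cover : ∀ {P} {p' : C ⇒ D} {g' : B ⇒ D} {π₁ : P ⇒ C} {π₂ : P ⇒ B} →
                          QuasiPullback t f g p → IsPullback p' g' π₁ π₂ → p ≈ p' → g ≈ g' →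
                          (c : A ⇒ P) → π₁ ∘ c ≈ f → π₂ ∘ c ≈ t → Cover c
    QuasiPullback⇒Cover {P} {π₁ = π₁} {π₂} (sq , comparison-cover) ip p≈p' g≈g' c π₁c π₂c =
      Cover-resp-≈ (≈-sym c≈kc₀) (Cover-∘ comparison-cover (Iso⇒Cover k-iso))
      where
        module I = IsPullbackProps ip
        k : O.P ⇒ P
        k = I.universal O.p₁ O.p₂
              (≈-trans (≈-sym p≈p' ⟩∘⟨refl) (≈-trans O.commute (g≈g' ⟩∘⟨refl)))
        k-iso : Iso k
        k-iso = IsPullback-Iso O.isPullback ip p≈p' g≈g' k (I.p₁∘universal _) (I.p₂∘universal _)
        c≈kc₀ : c ≈ k ∘ ⟨ f , t ⟩[ sq ]
        c≈kc₀ = I.unique-diagram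
          (≈-trans π₁c (≈-sym (≈-trans (I.p₁∘universal∘ _) (O.p₁∘universal sq))))
          (≈-trans π₂c (≈-sym (≈-trans (I.p₂∘universal∘ _) (O.p₂∘universal sq))))

    Cover⇒QuasiPullback : ∀ {P} {π₁ : P ⇒ C} {π₂ : P ⇒ B} → IsPullback p g π₁ π₂ →
                          (c : A ⇒ P) → π₁ ∘ c ≈ f → π₂ ∘ c ≈ t → Cover c →
                          QuasiPullback t f g p
    Cover⇒QuasiPullback {P} {π₁ = π₁} {π₂} ip c π₁c π₂c c-cover =
      sq , Cover-resp-≈ (≈-sym c₀≈kc) (Cover-∘ c-cover (Iso⇒Cover k-iso))
      where
        module I = IsPullbackProps ip
        sq : p ∘ f ≈ g ∘ t
        sq = ≈-trans (refl⟩∘⟨ ≈-sym π₁c) (≈-trans I.commute∘ (refl⟩∘⟨ π₂c))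
        k : P ⇒ O.P
        k = O.universal π₁ π₂ I.commute
        k-iso : Iso k
        k-iso = IsPullback-Iso ip O.isPullback ≈-refl ≈-refl k (O.p₁∘universal _) (O.p₂∘universal _)
        c₀≈kc : ⟨ f , t ⟩[ sq ] ≈ k ∘ c
        c₀≈kc = O.unique-diagram
          (≈-trans (O.p₁∘universal sq) (≈-sym (≈-trans (O.p₁∘universal∘ _) π₁c)))
          (≈-trans (O.p₂∘universal sq) (≈-sym (≈-trans (O.p₂∘universal∘ _) π₂c)))

  module _ {A B C D} {t : A ⇒ B} {f : A ⇒ C} {g : B ⇒ D} {p : C ⇒ D} where
    private module O = PullbackProps (pullback p g)

    QuasiPullback-transpose : QuasiPullback t f g p → QuasiPullback f t p g
    QuasiPullback-transpose (sq , comparison-cover) =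
      Cover⇒QuasiPullback (IsPullback-swap O.isPullback) ⟨ f , t ⟩[ sq ]
        (O.p₂∘universal sq) (O.p₁∘universal sq) comparison-cover

    QuasiPullback-top-cover : QuasiPullback t f g p → Cover p → Cover t
    QuasiPullback-top-cover (sq , comparison-cover) p-cover =
      Cover-resp-≈ (O.p₂∘universal sq)
        (Cover-∘ comparison-cover (cover-stable (IsPullback-swap O.isPullback) p-cover))

    QuasiPullback-resp-top : ∀ {t' : A ⇒ B} → t ≈ t' → QuasiPullback t f g p → QuasiPullback t' f g p
    QuasiPullback-resp-top t≈t' (sq , comparison-cover) =
      Cover⇒QuasiPullback O.isPullback ⟨ f , t ⟩[ sq ]
        (O.p₁∘universal sq) (≈-trans (O.p₂∘universal sq) t≈t') comparison-cover

  IsPullback⇒QuasiPullback : ∀ {A B C D} {t : A ⇒ B} {f : A ⇒ C} {g : B ⇒ D} {p : C ⇒ D} →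
                             IsPullback p g f t → QuasiPullback t f g p
  IsPullback⇒QuasiPullback ip = Cover⇒QuasiPullback ip id identityʳ identityʳ (Iso⇒Cover id-Iso)

  QuasiPullback-paste : ∀ {A₁ A₂ A₃ C₁ C₂ C₃} {t₁ : A₁ ⇒ A₂} {t₂ : A₂ ⇒ A₃}
                          {f₁ : A₁ ⇒ C₁} {f₂ : A₂ ⇒ C₂} {f₃ : A₃ ⇒ C₃} {p₁ : C₁ ⇒ C₂} {p₂ : C₂ ⇒ C₃} →
                        QuasiPullback t₁ f₁ f₂ p₁ → QuasiPullback t₂ f₂ f₃ p₂ →
                        QuasiPullback (t₂ ∘ t₁) f₁ f₃ (p₂ ∘ p₁)
  QuasiPullback-paste {A₁} {A₂} {t₁ = t₁} {t₂} {f₁} {f₂} {f₃} {p₁} {p₂} left (sq₂ , c₂-cover) =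
    sq , Cover-resp-≈ (K.p₁∘universal F-eq) (Cover-∘ ν-cover K₁-cover)
    where
      module R = PullbackProps (pullback p₂ f₃)
      module O = PullbackProps (pullback (p₂ ∘ p₁) f₃)
      sq : (p₂ ∘ p₁) ∘ f₁ ≈ f₃ ∘ (t₂ ∘ t₁)
      sq = begin
        (p₂ ∘ p₁) ∘ f₁  ≈⟨ assoc ⟩
        p₂ ∘ (p₁ ∘ f₁)  ≈⟨ refl⟩∘⟨ proj₁ left ⟩
        p₂ ∘ (f₂ ∘ t₁)  ≈⟨ pullˡ sq₂ ⟩
        (f₃ ∘ t₂) ∘ t₁  ≈⟨ assoc ⟩
        f₃ ∘ (t₂ ∘ t₁)  ∎
      c : A₁ ⇒ O.P
      c = ⟨ f₁ , t₂ ∘ t₁ ⟩[ sq ]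
      c₂ : A₂ ⇒ R.P
      c₂ = ⟨ f₂ , t₂ ⟩[ sq₂ ]
      F : O.P ⇒ R.P
      F = R.universal (p₁ ∘ O.p₁) O.p₂ (≈-trans sym-assoc O.commute)
      F-square : IsPullback p₁ R.p₁ O.p₁ F
      F-square = IsPullback-unpaste R.isPullback O.isPullback (R.p₁∘universal _) (R.p₂∘universal _)
      module K = PullbackProps (pullback F c₂)
      K₁-cover : Cover K.p₁
      K₁-cover = cover-stable K.isPullback c₂-cover
      K-square : IsPullback p₁ (R.p₁ ∘ c₂) (O.p₁ ∘ K.p₁) K.p₂
      K-square = IsPullback-swap (IsPullback-paste (IsPullback-swap F-square)
                                                  (IsPullback-swap K.isPullback))
      F-eq : F ∘ c ≈ c₂ ∘ t₁
      F-eq = R.unique-diagram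
        (begin
          R.p₁ ∘ (F ∘ c)    ≈⟨ R.p₁∘universal∘ _ ⟩
          (p₁ ∘ O.p₁) ∘ c   ≈⟨ assoc ⟩
          p₁ ∘ (O.p₁ ∘ c)   ≈⟨ refl⟩∘⟨ O.p₁∘universal sq ⟩
          p₁ ∘ f₁           ≈⟨ proj₁ left ⟩
          f₂ ∘ t₁           ≈⟨ ≈-sym (R.p₁∘universal∘ sq₂) ⟩
          R.p₁ ∘ (c₂ ∘ t₁)  ∎)
        (begin
          R.p₂ ∘ (F ∘ c)    ≈⟨ R.p₂∘universal∘ _ ⟩
          O.p₂ ∘ c          ≈⟨ O.p₂∘universal sq ⟩
          t₂ ∘ t₁           ≈⟨ ≈-sym (R.p₂∘universal∘ sq₂) ⟩
          R.p₂ ∘ (c₂ ∘ t₁)  ∎)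
      ν-cover : Cover (K.universal c t₁ F-eq)
      ν-cover = QuasiPullback⇒Cover left K-square ≈-refl (≈-sym (R.p₁∘universal sq₂)) _
        (≈-trans assoc (≈-trans (refl⟩∘⟨ K.p₁∘universal F-eq) (O.p₁∘universal sq)))
        (K.p₂∘universal F-eq)

  !ₜ∘-unique : ∀ {Z X Y} (x : Z ⇒ X) (y : Z ⇒ Y) → !ₜ ∘ x ≈ !ₜ ∘ y
  !ₜ∘-unique {Z} x y = ≈-trans (proj₂ (𝟏-terminal Z) _) (≈-sym (proj₂ (𝟏-terminal Z) _))

  module Product (X Y : Obj) = PullbackProps (pullback (!ₜ {X}) (!ₜ {Y}))

  ⟨_,_⟩ₓ : ∀ {Z X Y} → Z ⇒ X → Z ⇒ Y → Z ⇒ X ×ₒ Y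
  ⟨ x , y ⟩ₓ = ⟨ x , y ⟩[ !ₜ∘-unique x y ]

  π₁∘Δ∘ : ∀ {X Z} {x : Z ⇒ X} → Product.p₁ X X ∘ (Δ ∘ x) ≈ x
  π₁∘Δ∘ {X} = ≈-trans (Product.p₁∘universal∘ X X ≈-refl) identityˡ

  π₂∘Δ∘ : ∀ {X Z} {x : Z ⇒ X} → Product.p₂ X X ∘ (Δ ∘ x) ≈ x
  π₂∘Δ∘ {X} = ≈-trans (Product.p₂∘universal∘ X X ≈-refl) identityˡ

  -- For w : V ⇒ W, the pullback T ×_V S sits inside T ×_W S as the pullback of the diagonal of V.
  module Graph {P S T V W} {g : T ⇒ V} {f : S ⇒ V} {π₁ : P ⇒ T} {π₂ : P ⇒ S}
               (ip : IsPullback g f π₁ π₂) (w : V ⇒ W) where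
    module I = IsPullbackProps ip
    module K = PullbackProps (pullback (w ∘ g) (w ∘ f))
    module V² = Product V V

    graph : P ⇒ K.P
    graph = K.universal π₁ π₂ (≈-trans assoc (≈-trans (refl⟩∘⟨ I.commute) sym-assoc))

    graph-isPullback : IsPullback ⟨ g ∘ K.p₁ , f ∘ K.p₂ ⟩ₓ Δ graph (g ∘ π₁)
    graph-isPullback = mkIsPullback
      (V².unique-diagram
        (≈-trans (V².p₁∘universal∘ _) (≈-trans assoc (≈-trans (refl⟩∘⟨ K.p₁∘universal _)
                 (≈-sym π₁∘Δ∘))))
        (≈-trans (V².p₂∘universal∘ _) (≈-trans assoc (≈-trans (refl⟩∘⟨ K.p₂∘universal _)
                 (≈-trans (≈-sym I.commute) (≈-sym π₂∘Δ∘))))))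
      (λ eq₁ _ → I.unique-diagram
        (≈-trans (pushˡ (≈-sym (K.p₁∘universal _))) (≈-trans (refl⟩∘⟨ eq₁) (pullˡ (K.p₁∘universal _))))
        (≈-trans (pushˡ (≈-sym (K.p₂∘universal _))) (≈-trans (refl⟩∘⟨ eq₁) (pullˡ (K.p₂∘universal _)))))
      (λ h₁ h₂ eq → I.universal (K.p₁ ∘ h₁) (K.p₂ ∘ h₁) (g-eq eq))
      (λ eq → K.unique-diagram
        (≈-trans (K.p₁∘universal∘ _) (I.p₁∘universal (g-eq eq)))
        (≈-trans (K.p₂∘universal∘ _) (I.p₂∘universal (g-eq eq))))
      (λ eq → ≈-trans assoc (≈-trans (refl⟩∘⟨ I.p₁∘universal (g-eq eq)) (diagonal₁ eq)))
      where
        diagonal₁ : ∀ {Z} {h₁ : Z ⇒ K.P} {h₂ : Z ⇒ V} → ⟨ g ∘ K.p₁ , f ∘ K.p₂ ⟩ₓ ∘ h₁ ≈ Δ ∘ h₂ →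
                    g ∘ (K.p₁ ∘ h₁) ≈ h₂
        diagonal₁ eq = ≈-trans sym-assoc (≈-trans (≈-sym (V².p₁∘universal∘ _))
                         (≈-trans (refl⟩∘⟨ eq) π₁∘Δ∘))
        diagonal₂ : ∀ {Z} {h₁ : Z ⇒ K.P} {h₂ : Z ⇒ V} → ⟨ g ∘ K.p₁ , f ∘ K.p₂ ⟩ₓ ∘ h₁ ≈ Δ ∘ h₂ →
                    f ∘ (K.p₂ ∘ h₁) ≈ h₂
        diagonal₂ eq = ≈-trans sym-assoc (≈-trans (≈-sym (V².p₂∘universal∘ _))
                         (≈-trans (refl⟩∘⟨ eq) π₂∘Δ∘))
        g-eq : ∀ {Z} {h₁ : Z ⇒ K.P} {h₂ : Z ⇒ V} → ⟨ g ∘ K.p₁ , f ∘ K.p₂ ⟩ₓ ∘ h₁ ≈ Δ ∘ h₂ →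
               g ∘ (K.p₁ ∘ h₁) ≈ f ∘ (K.p₂ ∘ h₁)
        g-eq eq = ≈-trans (diagonal₁ eq) (≈-sym (diagonal₂ eq))

  module MVSProps {B A X : Obj} (φ : B ⇒ A) (a : A ⇒ X) where
    open MVS φ a public

    module A/ {W} (w : W ⇒ X) = PullbackProps (pullback a w)
    module B/ {W} (w : W ⇒ X) = PullbackProps (pullback (a ∘ φ) w)

    φ[]-isPullback : ∀ {W} (w : W ⇒ X) → IsPullback φ (A/.p₁ w) (B/.p₁ w) φ[ w ]
    φ[]-isPullback w = IsPullback-unpaste (A/.isPullback w) (B/.isPullback w)
                                          (A/.p₁∘universal w _) (A/.p₂∘universal w _)

    reindexA : ∀ {U W} {u : U ⇒ X} {w : W ⇒ X} (k : U ⇒ W) → w ∘ k ≈ u → A[ u ] ⇒ A[ w ]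
    reindexA {u = u} {w} k eq =
      A/.universal w (A/.p₁ u) (k ∘ A/.p₂ u)
        (≈-trans (A/.commute u) (≈-trans (≈-sym eq ⟩∘⟨refl) assoc))

    reindexA-isPullback : ∀ {U W} {u : U ⇒ X} {w : W ⇒ X} (k : U ⇒ W) (eq : w ∘ k ≈ u) →
                          IsPullback k (A/.p₂ w) (A/.p₂ u) (reindexA k eq)
    reindexA-isPullback {u = u} {w} k eq =
      IsPullback-unpaste (IsPullback-swap (A/.isPullback w))
        (IsPullback-resp-≈ (≈-sym eq) ≈-refl (IsPullback-swap (A/.isPullback u)))
        (A/.p₂∘universal w _) (A/.p₁∘universal w _)

    reindex-p₁ : ∀ {U W Z} {u : U ⇒ X} {w : W ⇒ X} {k : U ⇒ W} {eq : w ∘ k ≈ u} {x : Z ⇒ B[ u ]} →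
                 B/.p₁ w ∘ (reindex k eq ∘ x) ≈ B/.p₁ u ∘ x
    reindex-p₁ {w = w} = B/.p₁∘universal∘ w _

    reindex-p₂ : ∀ {U W Z} {u : U ⇒ X} {w : W ⇒ X} {k : U ⇒ W} {eq : w ∘ k ≈ u} {x : Z ⇒ B[ u ]} →
                 B/.p₂ w ∘ (reindex k eq ∘ x) ≈ k ∘ (B/.p₂ u ∘ x)
    reindex-p₂ {w = w} = ≈-trans (B/.p₂∘universal∘ w _) assoc

    reindex-isPullback : ∀ {U W} {u : U ⇒ X} {w : W ⇒ X} (k : U ⇒ W) (eq : w ∘ k ≈ u) →
                         IsPullback (B/.p₂ w) k (reindex k eq) (B/.p₂ u)
    reindex-isPullback {u = u} {w} k eq = IsPullback-swap
      (IsPullback-unpaste (IsPullback-swap (B/.isPullback w))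
        (IsPullback-resp-≈ (≈-sym eq) ≈-refl (IsPullback-swap (B/.isPullback u)))
        (B/.p₂∘universal w _) (B/.p₁∘universal w _))

    reindex-∘ : ∀ {U V W} {u : U ⇒ X} {v : V ⇒ X} {w : W ⇒ X} {k : V ⇒ W} {k' : U ⇒ V}
                  {eq : w ∘ k ≈ v} {eq' : v ∘ k' ≈ u} {eq'' : w ∘ (k ∘ k') ≈ u} →
                reindex k eq ∘ reindex k' eq' ≈ reindex (k ∘ k') eq''
    reindex-∘ {u = u} {v} {w} {k} {k'} = B/.unique-diagram w
      (≈-trans reindex-p₁ (≈-trans (B/.p₁∘universal v _) (≈-sym (B/.p₁∘universal w _))))
      (begin
        B/.p₂ w ∘ (reindex k _ ∘ reindex k' _)  ≈⟨ reindex-p₂ ⟩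
        k ∘ (B/.p₂ v ∘ reindex k' _)            ≈⟨ refl⟩∘⟨ B/.p₂∘universal v _ ⟩
        k ∘ (k' ∘ B/.p₂ u)                      ≈⟨ sym-assoc ⟩
        (k ∘ k') ∘ B/.p₂ u                      ≈⟨ ≈-sym (B/.p₂∘universal w _) ⟩
        B/.p₂ w ∘ reindex (k ∘ k') _            ∎)

    φ[]-reindex : ∀ {U W} {u : U ⇒ X} {w : W ⇒ X} {k : U ⇒ W} {eq : w ∘ k ≈ u} →
                  reindexA k eq ∘ φ[ u ] ≈ φ[ w ] ∘ reindex k eq
    φ[]-reindex {u = u} {w} = A/.unique-diagram w
      (begin
        A/.p₁ w ∘ (reindexA _ _ ∘ φ[ u ])  ≈⟨ A/.p₁∘universal∘ w _ ⟩
        A/.p₁ u ∘ φ[ u ]                   ≈⟨ A/.p₁∘universal u _ ⟩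
        φ ∘ B/.p₁ u                        ≈⟨ refl⟩∘⟨ ≈-sym (B/.p₁∘universal w _) ⟩
        φ ∘ (B/.p₁ w ∘ reindex _ _)        ≈⟨ ≈-sym (≈-trans (A/.p₁∘universal∘ w _) assoc) ⟩
        A/.p₁ w ∘ (φ[ w ] ∘ reindex _ _)   ∎)
      (begin
        A/.p₂ w ∘ (reindexA _ _ ∘ φ[ u ])  ≈⟨ ≈-trans (A/.p₂∘universal∘ w _) assoc ⟩
        _ ∘ (A/.p₂ u ∘ φ[ u ])             ≈⟨ refl⟩∘⟨ A/.p₂∘universal u _ ⟩
        _ ∘ B/.p₂ u                        ≈⟨ ≈-sym (B/.p₂∘universal w _) ⟩
        B/.p₂ w ∘ reindex _ _              ≈⟨ ≈-sym (A/.p₂∘universal∘ w _) ⟩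
        A/.p₂ w ∘ (φ[ w ] ∘ reindex _ _)   ∎)

  record Image {A B} (f : A ⇒ B) : Set (o ⊔ ℓ ⊔ e) where
    field
      {Im}          : Obj
      q             : A ⇒ Im
      m             : Im ⇒ B
      q-cover       : Cover q
      m-mono        : Mono m
      factorisation : f ≈ m ∘ q

  image : ∀ {A B} (f : A ⇒ B) → Image f
  image f = let (_ , q , m , q-cover , m-mono , eq) = factor f in
    record { q = q ; m = m ; q-cover = q-cover ; m-mono = m-mono ; factorisation = eq }

  ≤-pullback-elim : ∀ {X Y Z M N S} {m : M ⇒ X} {n : N ⇒ Y} {ρ : Z ⇒ X} {ρ' : Z ⇒ Y}
                      {x : S ⇒ M} {β : S ⇒ Z} →
                    (ρ *) m ≤ₘ (ρ' *) n → m ∘ x ≈ ρ ∘ β → Σ[ x' ∈ S ⇒ N ] (n ∘ x' ≈ ρ' ∘ β)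
  ≤-pullback-elim {S = S} {m} {n} {ρ} {ρ'} {x} {β} (h , h-eq) mx≈ρβ = ρ'n.p₁ ∘ (h ∘ β') , (begin
    n ∘ (ρ'n.p₁ ∘ (h ∘ β'))   ≈⟨ ρ'n.commute∘ ⟩
    ρ' ∘ (ρ'n.p₂ ∘ (h ∘ β'))  ≈⟨ refl⟩∘⟨ pullˡ h-eq ⟩
    ρ' ∘ (ρm.p₂ ∘ β')         ≈⟨ refl⟩∘⟨ ρm.p₂∘universal mx≈ρβ ⟩
    ρ' ∘ β                    ∎)
    where
      module ρm = PullbackProps (pullback m ρ)
      module ρ'n = PullbackProps (pullback n ρ')
      β' : S ⇒ ρm.P
      β' = ρm.universal x β mx≈ρβ

  ≤-pullback-intro : ∀ {X Y Z N S} {x : Y ⇒ Z} {n : N ⇒ X} {ρ : Z ⇒ X} {σ : S ⇒ Y} {χ : S ⇒ N} →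
                     Cover σ → Mono n → n ∘ χ ≈ ρ ∘ (x ∘ σ) → x ≤ₘ (ρ *) n
  ≤-pullback-intro {n = n} {ρ} σ-cover n-mono eq =
    cover-mono-lift σ-cover (Mono-pullback ρn.isPullback n-mono) (ρn.p₂∘universal eq)
    where module ρn = PullbackProps (pullback n ρ)

  WeaklyInitial : ∀ {t} (𝒯 : MorClass t) {B A X} (φ : B ⇒ A) (a : A ⇒ X) {X' Y}
                  (q : X' ⇒ X) (y : Y ⇒ X') → MVS.DMVS φ a 𝒯 (q ∘ y) → Set (o ⊔ ℓ ⊔ e ⊔ t)
  WeaklyInitial 𝒯 φ a {X'} {Y} q y P =
    ∀ {Z} (z : Z ⇒ X') (Q : MVS.DMVS φ a 𝒯 (q ∘ z)) →
    Σ[ U ∈ Obj ] Σ[ k ∈ U ⇒ Y ] Σ[ l ∈ U ⇒ Z ]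
    Σ[ eq ∈ y ∘ k ≈ z ∘ l ]
      (Cover l ×
       ((MVS.reindex φ a k assoc *) (arr (MVS.DMVS.sub P)) ≤ₘ
        (MVS.reindex φ a l
           (≈-trans assoc (∘-resp-≈ ≈-refl (≈-sym eq))) *) (arr (MVS.DMVS.sub Q))))

  -- AxiomF 𝒯 unfolds to  ∀ φ a → 𝒯 φ → 𝒯 a → WeaklyInitialMVS 𝒯 φ a.
  WeaklyInitialMVS : ∀ {t} (𝒯 : MorClass t) {B A X} (φ : B ⇒ A) (a : A ⇒ X) → Set (o ⊔ ℓ ⊔ e ⊔ t)
  WeaklyInitialMVS 𝒯 {X = X} φ a =
    Σ[ X' ∈ Obj ] Σ[ q ∈ X' ⇒ X ] Σ[ Y ∈ Obj ] Σ[ y ∈ Y ⇒ X' ]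
    Σ[ P ∈ MVS.DMVS φ a 𝒯 (q ∘ y) ] (Cover q × 𝒯 y × WeaklyInitial 𝒯 φ a q y P)

module DisplayLemmas {o ℓ e s} (𝒞 : Category o ℓ e) (H : PositiveHeyting 𝒞)
                     (D : InPH.DisplayMaps 𝒞 H s) where
  open Category 𝒞
  open Notions 𝒞
  open PositiveHeyting H
  open InPH 𝒞 H
  open DisplayMaps D
  open CategoryLemmas 𝒞
  open RegularLemmas 𝒞 H

  𝒮-resp-≈ : ∀ {A C} {f f' : A ⇒ C} → f ≈ f' → 𝒮 f' → 𝒮 f
  𝒮-resp-≈ f≈f' = pullback-stable (IsPullback-id f≈f')

  𝒮-pullback-over : ∀ {P S T V W} {g : T ⇒ V} {f : S ⇒ V} {π₁ : P ⇒ T} {π₂ : P ⇒ S} →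
                    IsPullback g f π₁ π₂ → (w : V ⇒ W) → 𝒮 (w ∘ f) → 𝒮 π₁
  𝒮-pullback-over ip w wf∈𝒮 =
    𝒮-resp-≈ (≈-sym (K.p₁∘universal _))
      (composition (pullback-stable graph-isPullback diagonals)
                   (pullback-stable K.isPullback wf∈𝒮))
    where open Graph ip w

  𝒮-cancelʳ : ∀ {D T W} (w : T ⇒ W) {d : D ⇒ T} → 𝒮 (w ∘ d) → 𝒮 d
  𝒮-cancelʳ w = 𝒮-pullback-over (IsPullback-id ≈-refl) w

  covering-square : ∀ {A B C D} {t : A ⇒ B} {f : A ⇒ C} {g : B ⇒ D} {p : C ⇒ D} →
                    Cover p → QuasiPullback t f g p → CoveringSquare t f g p
  covering-square p-cover (sq , comparison-cover) = sq , p-cover , comparison-cover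

  𝒮⊆Cov : ∀ {A C} {f : A ⇒ C} → 𝒮 f → Cov 𝒮 f
  𝒮⊆Cov f∈𝒮 = _ , _ , _ , f∈𝒮 , id , id ,
    covering-square (Iso⇒Cover id-Iso) (IsPullback⇒QuasiPullback (IsPullback-id ≈-refl))

  -- The covering map is the projection T ×_V S → T; it lies in 𝒮 because w ∘ h ∘ f does.
  Cov-from-covers : ∀ {S T V W N} {f : S ⇒ T} {h : T ⇒ V} {g : N ⇒ V} {c : S ⇒ N} (w : V ⇒ W) →
                    𝒮 (w ∘ (h ∘ f)) → Cover h → Cover c → g ∘ c ≈ h ∘ f → Cov 𝒮 g
  Cov-from-covers {f = f} {h} {g} {c} w whf∈𝒮 h-cover c-cover gc≈hf =
    _ , _ , TN.p₁ ∘ E.p₁ , 𝒮-pullback-over E-square w whf∈𝒮 , c ∘ E.p₂ , h ,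
    covering-square h-cover
      (Cover⇒QuasiPullback TN.isPullback E.p₁ ≈-refl E.commute (cover-stable E.isPullback c-cover))
    where
      module TN = PullbackProps (pullback h g)
      module E = PullbackProps (pullback TN.p₂ c)
      E-square : IsPullback h (h ∘ f) (TN.p₁ ∘ E.p₁) E.p₂
      E-square = IsPullback-resp-≈ ≈-refl gc≈hf (IsPullback-swap
        (IsPullback-paste (IsPullback-swap TN.isPullback) (IsPullback-swap E.isPullback)))

  CollectionSquare : ∀ {Y X A} (p : Y ⇒ X) (f : X ⇒ A) → Set (o ⊔ ℓ ⊔ e ⊔ s)
  CollectionSquare {Y} {X} {A} p f =
    Σ[ B ∈ Obj ] Σ[ C ∈ Obj ] Σ[ g ∈ B ⇒ C ] Σ[ t ∈ B ⇒ Y ] Σ[ r ∈ C ⇒ A ]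
      (𝒮 g × CoveringSquare (p ∘ t) g f r)

  record CoveredBy𝒮 {B A X} (φ : B ⇒ A) (a : A ⇒ X) : Set (o ⊔ ℓ ⊔ e ⊔ s) where
    field
      {B₀ A₀ X₀} : Obj
      φ₀       : B₀ ⇒ A₀
      a₀       : A₀ ⇒ X₀
      φ₀∈𝒮     : 𝒮 φ₀
      a₀∈𝒮     : 𝒮 a₀
      b₀       : B₀ ⇒ B
      t₀       : A₀ ⇒ A
      x₀       : X₀ ⇒ X
      x₀-cover : Cover x₀
      φ-square : QuasiPullback b₀ φ₀ φ t₀
      a-square : QuasiPullback t₀ a₀ a x₀

  -- Collection applied to the cover A' ×_A A'' → A' refines both covering squares over a common A₀.
  covered-by-𝒮 : ∀ {B A X} {φ : B ⇒ A} {a : A ⇒ X} → Cov 𝒮 φ → Cov 𝒮 a → CoveredBy𝒮 φ a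
  covered-by-𝒮 {φ = φ} {a} (_ , _ , φ' , φ'∈𝒮 , b' , r , sqφ , r-cover , φ'-comparison)
                            (_ , _ , a' , a'∈𝒮 , t' , p , sqa , p-cover , a'-comparison) =
    refine (collection AA.p₁ a' (cover-stable AA.isPullback r-cover) a'∈𝒮)
    where
      module AA = PullbackProps (pullback t' r)
      refine : CollectionSquare AA.p₁ a' → CoveredBy𝒮 φ a
      refine (_ , _ , a₀ , τ , ρ , a₀∈𝒮 , sqc , ρ-cover , a₀-comparison) = record
        { φ₀ = B₀.p₁ ; a₀ = a₀
        ; φ₀∈𝒮 = pullback-stable B₀.isPullback φ'∈𝒮 ; a₀∈𝒮 = a₀∈𝒮
        ; b₀ = b' ∘ B₀.p₂ ; t₀ = r ∘ (AA.p₂ ∘ τ) ; x₀ = p ∘ ρ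
        ; x₀-cover = Cover-∘ ρ-cover p-cover
        ; φ-square = QuasiPullback-paste (IsPullback⇒QuasiPullback B₀.isPullback)
                                         (sqφ , φ'-comparison)
        ; a-square = QuasiPullback-resp-top (≈-trans sym-assoc (≈-trans (AA.commute ⟩∘⟨refl) assoc))
                       (QuasiPullback-paste (sqc , a₀-comparison) (sqa , a'-comparison))
        }
        where module B₀ = PullbackProps (pullback (AA.p₂ ∘ τ) φ')

  module OverCoveredPair {B A X} {φ : B ⇒ A} {a : A ⇒ X} (C : CoveredBy𝒮 φ a) where
    open CoveredBy𝒮 C
    module M  = MVSProps φ a
    module M₀ = MVSProps φ₀ a₀

    module BaseChange {X'} (q₀ : X' ⇒ X₀) {Z} (z : Z ⇒ X') where
      module Aw  = M.A/ ((x₀ ∘ q₀) ∘ z)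
      module Bw  = M.B/ ((x₀ ∘ q₀) ∘ z)
      module A₀v = M₀.A/ (q₀ ∘ z)
      module B₀v = M₀.B/ (q₀ ∘ z)

      over-base : ∀ {Y} {x : Y ⇒ A₀} {y : Y ⇒ Z} → a₀ ∘ x ≈ (q₀ ∘ z) ∘ y →
                  a ∘ (t₀ ∘ x) ≈ ((x₀ ∘ q₀) ∘ z) ∘ y
      over-base {x = x} {y} eq = begin
        a ∘ (t₀ ∘ x)              ≈⟨ pullˡ (≈-sym (proj₁ a-square)) ⟩
        (x₀ ∘ a₀) ∘ x             ≈⟨ assoc ⟩
        x₀ ∘ (a₀ ∘ x)             ≈⟨ refl⟩∘⟨ eq ⟩
        x₀ ∘ ((q₀ ∘ z) ∘ y)       ≈⟨ sym-assoc ⟩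
        (x₀ ∘ (q₀ ∘ z)) ∘ y       ≈⟨ sym-assoc ⟩∘⟨refl ⟩
        ((x₀ ∘ q₀) ∘ z) ∘ y       ∎

      jA : M₀.A[ q₀ ∘ z ] ⇒ M.A[ (x₀ ∘ q₀) ∘ z ]
      jA = Aw.universal (t₀ ∘ A₀v.p₁) A₀v.p₂ (over-base A₀v.commute)

      jB : M₀.B[ q₀ ∘ z ] ⇒ M.B[ (x₀ ∘ q₀) ∘ z ]
      jB = Bw.universal (b₀ ∘ B₀v.p₁) B₀v.p₂ (begin
        (a ∘ φ) ∘ (b₀ ∘ B₀v.p₁)   ≈⟨ assoc ⟩
        a ∘ (φ ∘ (b₀ ∘ B₀v.p₁))   ≈⟨ refl⟩∘⟨ pullˡ (≈-sym (proj₁ φ-square)) ⟩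
        a ∘ ((t₀ ∘ φ₀) ∘ B₀v.p₁)  ≈⟨ refl⟩∘⟨ assoc ⟩
        a ∘ (t₀ ∘ (φ₀ ∘ B₀v.p₁))  ≈⟨ over-base (≈-trans sym-assoc B₀v.commute) ⟩
        ((x₀ ∘ q₀) ∘ z) ∘ B₀v.p₂  ∎)

      jB-p₁ : ∀ {Y} {x : Y ⇒ M₀.B[ q₀ ∘ z ]} → Bw.p₁ ∘ (jB ∘ x) ≈ b₀ ∘ (B₀v.p₁ ∘ x)
      jB-p₁ = ≈-trans (Bw.p₁∘universal∘ _) assoc

      jB-p₂ : ∀ {Y} {x : Y ⇒ M₀.B[ q₀ ∘ z ]} → Bw.p₂ ∘ (jB ∘ x) ≈ B₀v.p₂ ∘ x
      jB-p₂ = Bw.p₂∘universal∘ _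

      jA-cover : Cover jA
      jA-cover = QuasiPullback⇒Cover
        (QuasiPullback-paste (IsPullback⇒QuasiPullback (IsPullback-swap A₀v.isPullback)) a-square)
        (IsPullback-swap Aw.isPullback) sym-assoc ≈-refl jA (Aw.p₂∘universal _) (Aw.p₁∘universal _)

      jB-commute : jA ∘ M₀.φ[ q₀ ∘ z ] ≈ M.φ[ (x₀ ∘ q₀) ∘ z ] ∘ jB
      jB-commute = Aw.unique-diagram
        (begin
          Aw.p₁ ∘ (jA ∘ M₀.φ[ q₀ ∘ z ])   ≈⟨ ≈-trans (Aw.p₁∘universal∘ _) assoc ⟩
          t₀ ∘ (A₀v.p₁ ∘ M₀.φ[ q₀ ∘ z ])  ≈⟨ refl⟩∘⟨ A₀v.p₁∘universal _ ⟩
          t₀ ∘ (φ₀ ∘ B₀v.p₁)              ≈⟨ pullˡ (proj₁ φ-square) ⟩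
          (φ ∘ b₀) ∘ B₀v.p₁               ≈⟨ assoc ⟩
          φ ∘ (b₀ ∘ B₀v.p₁)               ≈⟨ refl⟩∘⟨ ≈-sym (Bw.p₁∘universal _) ⟩
          φ ∘ (Bw.p₁ ∘ jB)                ≈⟨ ≈-sym (≈-trans (Aw.p₁∘universal∘ _) assoc) ⟩
          Aw.p₁ ∘ (M.φ[ _ ] ∘ jB)         ∎)
        (begin
          Aw.p₂ ∘ (jA ∘ M₀.φ[ q₀ ∘ z ])   ≈⟨ Aw.p₂∘universal∘ _ ⟩
          A₀v.p₂ ∘ M₀.φ[ q₀ ∘ z ]         ≈⟨ A₀v.p₂∘universal _ ⟩
          B₀v.p₂                          ≈⟨ ≈-sym (Bw.p₂∘universal _) ⟩
          Bw.p₂ ∘ jB                      ≈⟨ ≈-sym (Aw.p₂∘universal∘ _) ⟩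
          Aw.p₂ ∘ (M.φ[ _ ] ∘ jB)         ∎)

      -- As Bw = B ×_A Aw, this comparison is that of the φ-square pasted with B₀v over A₀v.
      jB-square : QuasiPullback jB M₀.φ[ q₀ ∘ z ] M.φ[ (x₀ ∘ q₀) ∘ z ] jA
      jB-square = jB-commute , QuasiPullback⇒Cover
        (QuasiPullback-paste
          (IsPullback⇒QuasiPullback (IsPullback-swap (M₀.φ[]-isPullback (q₀ ∘ z)))) φ-square)
        (IsPullback-paste (IsPullback-swap (M.φ[]-isPullback _)) R.isPullback)
        (≈-sym (Aw.p₁∘universal _)) ≈-refl _
        (R.p₁∘universal jB-commute)
        (≈-trans assoc (≈-trans (refl⟩∘⟨ R.p₂∘universal jB-commute) (Bw.p₁∘universal _)))
        where module R = PullbackProps (pullback jA M.φ[ (x₀ ∘ q₀) ∘ z ])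

      A₀v-p₂∈𝒮 : 𝒮 A₀v.p₂
      A₀v-p₂∈𝒮 = pullback-stable (IsPullback-swap A₀v.isPullback) a₀∈𝒮

      module Push (P₀ : M₀.DMVS 𝒮 (q₀ ∘ z)) where
        open Image (image (jB ∘ arr (M₀.sub P₀))) public

        image-square : (M.φ[ (x₀ ∘ q₀) ∘ z ] ∘ m) ∘ q ≈ jA ∘ (M₀.φ[ q₀ ∘ z ] ∘ arr (M₀.sub P₀))
        image-square = begin
          (M.φ[ _ ] ∘ m) ∘ q                  ≈⟨ assoc ⟩
          M.φ[ _ ] ∘ (m ∘ q)                  ≈⟨ refl⟩∘⟨ ≈-sym factorisation ⟩
          M.φ[ _ ] ∘ (jB ∘ arr (M₀.sub P₀))   ≈⟨ pullˡ (≈-sym jB-commute) ⟩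
          (jA ∘ M₀.φ[ _ ]) ∘ arr (M₀.sub P₀)  ≈⟨ assoc ⟩
          jA ∘ (M₀.φ[ _ ] ∘ arr (M₀.sub P₀))  ∎

        pushed : M.DMVS (Cov 𝒮) ((x₀ ∘ q₀) ∘ z)
        pushed = record
          { sub       = record { dom = Im ; arr = m ; mono = m-mono }
          ; cover     = Cover-factorˡ (Cover-resp-≈ (≈-sym image-square)
                                                    (Cover-∘ (M₀.cover P₀) jA-cover))
          ; displayed = Cov-from-covers Aw.p₂
              (𝒮-resp-≈ (pullˡ (Aw.p₂∘universal _)) (composition (M₀.displayed P₀) A₀v-p₂∈𝒮))
              jA-cover q-cover image-square
          }

      record Pulled (Q : M.DMVS (Cov 𝒮) ((x₀ ∘ q₀) ∘ z)) : Set (o ⊔ ℓ ⊔ e ⊔ s) where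
        field
          {Z₁}    : Obj
          r       : Z₁ ⇒ Z
          r-cover : Cover r
          Q₀      : M₀.DMVS 𝒮 (q₀ ∘ (z ∘ r))
          Q₀≤Q    : (jB ∘ (M₀.reindex r assoc ∘ arr (M₀.sub Q₀))) ≤ₘ arr (M.sub Q)

      module Pull (Q : M.DMVS (Cov 𝒮) ((x₀ ∘ q₀) ∘ z)) where
        module Q' = PullbackProps (pullback (arr (M.sub Q)) jB)

        φ₀Q'-cover : Cover (M₀.φ[ q₀ ∘ z ] ∘ Q'.p₂)
        φ₀Q'-cover = QuasiPullback-top-cover
          (QuasiPullback-paste (IsPullback⇒QuasiPullback Q'.isPullback)
                               (QuasiPullback-transpose jB-square))
          (M.cover Q)

        module Refine {D₁ Z₁} (g : D₁ ⇒ Z₁) (τ : D₁ ⇒ Q'.P) (r : Z₁ ⇒ Z) (g∈𝒮 : 𝒮 g)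
                      (square : QuasiPullback ((M₀.φ[ q₀ ∘ z ] ∘ Q'.p₂) ∘ τ) g A₀v.p₂ r) where
          module A₀₁ = M₀.A/ (q₀ ∘ (z ∘ r))
          module B₀₁ = M₀.B/ (q₀ ∘ (z ∘ r))

          r∘g : r ∘ g ≈ B₀v.p₂ ∘ (Q'.p₂ ∘ τ)
          r∘g = ≈-trans (proj₁ square) (≈-trans (refl⟩∘⟨ assoc) (A₀v.p₂∘universal∘ _))

          d : D₁ ⇒ M₀.B[ q₀ ∘ (z ∘ r) ]
          d = B₀₁.universal (B₀v.p₁ ∘ (Q'.p₂ ∘ τ)) g (begin
            (a₀ ∘ φ₀) ∘ (B₀v.p₁ ∘ (Q'.p₂ ∘ τ))  ≈⟨ B₀v.commute∘ ⟩
            (q₀ ∘ z) ∘ (B₀v.p₂ ∘ (Q'.p₂ ∘ τ))   ≈⟨ refl⟩∘⟨ ≈-sym r∘g ⟩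
            (q₀ ∘ z) ∘ (r ∘ g)                  ≈⟨ sym-assoc ⟩
            ((q₀ ∘ z) ∘ r) ∘ g                  ≈⟨ assoc ⟩∘⟨refl ⟩
            (q₀ ∘ (z ∘ r)) ∘ g                  ∎)

          d∈𝒮 : 𝒮 d
          d∈𝒮 = 𝒮-cancelʳ B₀₁.p₂ (𝒮-resp-≈ (B₀₁.p₂∘universal _) g∈𝒮)

          reindex-d : Q'.p₂ ∘ τ ≈ M₀.reindex r assoc ∘ d
          reindex-d = B₀v.unique-diagram
            (≈-sym (≈-trans M₀.reindex-p₁ (B₀₁.p₁∘universal _)))
            (≈-sym (≈-trans M₀.reindex-p₂ (≈-trans (refl⟩∘⟨ B₀₁.p₂∘universal _) r∘g)))

          φ₀d-cover : Cover (M₀.φ[ q₀ ∘ (z ∘ r) ] ∘ d)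
          φ₀d-cover = QuasiPullback⇒Cover square (M₀.reindexA-isPullback r assoc) ≈-refl ≈-refl _
            (≈-trans (A₀₁.p₂∘universal∘ _) (B₀₁.p₂∘universal _))
            (begin
              M₀.reindexA r assoc ∘ (M₀.φ[ _ ] ∘ d)      ≈⟨ pullˡ M₀.φ[]-reindex ⟩
              (M₀.φ[ q₀ ∘ z ] ∘ M₀.reindex r assoc) ∘ d  ≈⟨ assoc ⟩
              M₀.φ[ q₀ ∘ z ] ∘ (M₀.reindex r assoc ∘ d)  ≈⟨ refl⟩∘⟨ ≈-sym reindex-d ⟩
              M₀.φ[ q₀ ∘ z ] ∘ (Q'.p₂ ∘ τ)               ≈⟨ sym-assoc ⟩
              (M₀.φ[ q₀ ∘ z ] ∘ Q'.p₂) ∘ τ               ∎)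

          open Image (image d)

          Q₀ : M₀.DMVS 𝒮 (q₀ ∘ (z ∘ r))
          Q₀ = record
            { sub       = record { dom = Im ; arr = m ; mono = m-mono }
            ; cover     = Cover-factorˡ (Cover-resp-≈ (≈-trans (refl⟩∘⟨ factorisation) sym-assoc)
                                                      φ₀d-cover)
            ; displayed = composition (images q-cover m-mono (𝒮-resp-≈ (≈-sym factorisation) d∈𝒮))
                                      (pullback-stable (IsPullback-swap (M₀.φ[]-isPullback _)) φ₀∈𝒮)
            }

          Q₀≤Q : (jB ∘ (M₀.reindex r assoc ∘ m)) ≤ₘ arr (M.sub Q)
          Q₀≤Q = cover-mono-lift q-cover (mono (M.sub Q)) (begin
            arr (M.sub Q) ∘ (Q'.p₁ ∘ τ)          ≈⟨ Q'.commute∘ ⟩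
            jB ∘ (Q'.p₂ ∘ τ)                     ≈⟨ refl⟩∘⟨ reindex-d ⟩
            jB ∘ (M₀.reindex r assoc ∘ d)        ≈⟨ refl⟩∘⟨ (refl⟩∘⟨ factorisation) ⟩
            jB ∘ (M₀.reindex r assoc ∘ (m ∘ q))  ≈⟨ refl⟩∘⟨ sym-assoc ⟩
            jB ∘ ((M₀.reindex r assoc ∘ m) ∘ q)  ≈⟨ sym-assoc ⟩
            (jB ∘ (M₀.reindex r assoc ∘ m)) ∘ q  ∎)

      pull : (Q : M.DMVS (Cov 𝒮) ((x₀ ∘ q₀) ∘ z)) → Pulled Q
      pull Q = refine (collection _ A₀v.p₂ φ₀Q'-cover A₀v-p₂∈𝒮)
        where
          open Pull Q
          refine : CollectionSquare (M₀.φ[ q₀ ∘ z ] ∘ Q'.p₂) A₀v.p₂ → Pulled Q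
          refine (_ , _ , g , τ , r , g∈𝒮 , sq , r-cover , comparison) = record
            { r = r ; r-cover = r-cover ; Q₀ = Q₀ ; Q₀≤Q = Q₀≤Q }
            where open Refine g τ r g∈𝒮 (sq , comparison)

    module _ {X'} (q₀ : X' ⇒ X₀) {U Z} {u : U ⇒ X'} {z : Z ⇒ X'} {k : U ⇒ Z}
             {eq₀ : (q₀ ∘ z) ∘ k ≈ q₀ ∘ u} {eq : ((x₀ ∘ q₀) ∘ z) ∘ k ≈ (x₀ ∘ q₀) ∘ u} where
      private
        module Z = BaseChange q₀ z
        module U = BaseChange q₀ u

      jB-reindex : Z.jB ∘ M₀.reindex k eq₀ ≈ M.reindex k eq ∘ U.jB
      jB-reindex = Z.Bw.unique-diagram
        (begin
          Z.Bw.p₁ ∘ (Z.jB ∘ M₀.reindex k eq₀)  ≈⟨ Z.jB-p₁ ⟩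
          b₀ ∘ (Z.B₀v.p₁ ∘ M₀.reindex k eq₀)  ≈⟨ refl⟩∘⟨ Z.B₀v.p₁∘universal _ ⟩
          b₀ ∘ U.B₀v.p₁                       ≈⟨ ≈-sym (U.Bw.p₁∘universal _) ⟩
          U.Bw.p₁ ∘ U.jB                      ≈⟨ ≈-sym M.reindex-p₁ ⟩
          Z.Bw.p₁ ∘ (M.reindex k eq ∘ U.jB)   ∎)
        (begin
          Z.Bw.p₂ ∘ (Z.jB ∘ M₀.reindex k eq₀)  ≈⟨ Z.jB-p₂ ⟩
          Z.B₀v.p₂ ∘ M₀.reindex k eq₀         ≈⟨ Z.B₀v.p₂∘universal _ ⟩
          k ∘ U.B₀v.p₂                        ≈⟨ refl⟩∘⟨ ≈-sym (U.Bw.p₂∘universal _) ⟩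
          k ∘ (U.Bw.p₂ ∘ U.jB)                ≈⟨ ≈-sym M.reindex-p₂ ⟩
          Z.Bw.p₂ ∘ (M.reindex k eq ∘ U.jB)   ∎)

      -- Opaque: its universal map is used only through its equations, and unfolding it
      -- makes conversion checking blow up.
      opaque
        jB-reindex-isPullback : IsPullback Z.jB (M.reindex k eq) (M₀.reindex k eq₀) U.jB
        jB-reindex-isPullback = IsPullback-unpaste (M.reindex-isPullback k eq)
          (IsPullback-resp-≈ (≈-sym (Z.Bw.p₂∘universal _)) ≈-refl (M₀.reindex-isPullback k eq₀))
          (≈-sym jB-reindex) (U.Bw.p₂∘universal _)

    module Transport {X'} (q₀ : X' ⇒ X₀) {Y} (y : Y ⇒ X') (P₀ : M₀.DMVS 𝒮 (q₀ ∘ y)) where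
      private module BY = BaseChange q₀ y

      P : M.DMVS (Cov 𝒮) ((x₀ ∘ q₀) ∘ y)
      P = BY.Push.pushed P₀

      module Chase {Z} {z : Z ⇒ X'} {Q : M.DMVS (Cov 𝒮) ((x₀ ∘ q₀) ∘ z)}
                   (pulled : BaseChange.Pulled q₀ z Q) where
        open BaseChange.Pulled pulled
        open BY.Push P₀ using (m; q; q-cover; factorisation)
        private module BZ = BaseChange q₀ z

        module _ {U} (k : U ⇒ Y) (l : U ⇒ Z₁) (eq₀ : y ∘ k ≈ (z ∘ r) ∘ l)
                 (k*P₀≤l*Q₀ : (M₀.reindex k assoc *) (arr (M₀.sub P₀)) ≤ₘ
                              (M₀.reindex l (≈-trans assoc (∘-resp-≈ ≈-refl (≈-sym eq₀))) *)
                                (arr (M₀.sub Q₀)))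
                 (E : ((x₀ ∘ q₀) ∘ z) ∘ (r ∘ l) ≈ (x₀ ∘ q₀) ∘ (y ∘ k)) where
          private
            module BU = BaseChange q₀ (y ∘ k)
            module Pk = PullbackProps (pullback m (M.reindex k assoc))
            module S = PullbackProps (pullback Pk.p₁ q)

          x : S.P ⇒ M.B[ (x₀ ∘ q₀) ∘ (y ∘ k) ]
          x = Pk.p₂ ∘ S.p₁

          p : S.P ⇒ M₀.B[ q₀ ∘ y ]
          p = arr (M₀.sub P₀) ∘ S.p₂

          x∈k*P : BY.jB ∘ p ≈ M.reindex k assoc ∘ x
          x∈k*P = begin
            BY.jB ∘ (arr (M₀.sub P₀) ∘ S.p₂)  ≈⟨ pullˡ factorisation ⟩
            (m ∘ q) ∘ S.p₂                   ≈⟨ assoc ⟩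
            m ∘ (q ∘ S.p₂)                   ≈⟨ refl⟩∘⟨ ≈-sym S.commute ⟩
            m ∘ (Pk.p₁ ∘ S.p₁)               ≈⟨ Pk.commute∘ ⟩
            M.reindex k assoc ∘ x            ∎

          private
            module Sq = IsPullbackProps
              (jB-reindex-isPullback q₀ {u = y ∘ k} {z = y} {k = k} {assoc} {assoc})

          β : S.P ⇒ M₀.B[ q₀ ∘ (y ∘ k) ]
          β = Sq.universal p x x∈k*P

          β∈l*Q₀ : Σ[ x' ∈ S.P ⇒ Notions.dom (M₀.sub Q₀) ]
                     (arr (M₀.sub Q₀) ∘ x' ≈
                      M₀.reindex l (≈-trans assoc (∘-resp-≈ ≈-refl (≈-sym eq₀))) ∘ β)
          β∈l*Q₀ = ≤-pullback-elim k*P₀≤l*Q₀ (≈-sym (Sq.p₁∘universal x∈k*P))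

          rl-eq : (q₀ ∘ z) ∘ (r ∘ l) ≈ q₀ ∘ (y ∘ k)
          rl-eq = ≈-trans assoc (refl⟩∘⟨ ≈-trans sym-assoc (≈-sym eq₀))

          x∈rl*Q : arr (M.sub Q) ∘ (proj₁ Q₀≤Q ∘ proj₁ β∈l*Q₀) ≈ M.reindex (r ∘ l) E ∘ x
          x∈rl*Q = begin
            arr (M.sub Q) ∘ (proj₁ Q₀≤Q ∘ proj₁ β∈l*Q₀)
              ≈⟨ pullˡ (proj₂ Q₀≤Q) ⟩
            (BZ.jB ∘ (M₀.reindex r assoc ∘ arr (M₀.sub Q₀))) ∘ proj₁ β∈l*Q₀
              ≈⟨ ≈-trans assoc (refl⟩∘⟨ assoc) ⟩
            BZ.jB ∘ (M₀.reindex r assoc ∘ (arr (M₀.sub Q₀) ∘ proj₁ β∈l*Q₀))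
              ≈⟨ refl⟩∘⟨ (refl⟩∘⟨ proj₂ β∈l*Q₀) ⟩
            BZ.jB ∘ (M₀.reindex r assoc ∘ (M₀.reindex l _ ∘ β))
              ≈⟨ refl⟩∘⟨ pullˡ M₀.reindex-∘ ⟩
            BZ.jB ∘ (M₀.reindex (r ∘ l) rl-eq ∘ β)
              ≈⟨ pullˡ (jB-reindex q₀) ⟩
            (M.reindex (r ∘ l) E ∘ BU.jB) ∘ β
              ≈⟨ assoc ⟩
            M.reindex (r ∘ l) E ∘ (BU.jB ∘ β)
              ≈⟨ refl⟩∘⟨ Sq.p₂∘universal x∈k*P ⟩
            M.reindex (r ∘ l) E ∘ x
              ∎

          pushed-≤ : (M.reindex k assoc *) (arr (M.sub P)) ≤ₘ (M.reindex (r ∘ l) E *) (arr (M.sub Q))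
          pushed-≤ = ≤-pullback-intro (cover-stable S.isPullback q-cover) (mono (M.sub Q)) x∈rl*Q

      transfer : WeaklyInitial 𝒮 φ₀ a₀ q₀ y P₀ → WeaklyInitial (Cov 𝒮) φ a (x₀ ∘ q₀) y P
      transfer initial z Q =
        let pulled = BaseChange.pull q₀ z Q
            open BaseChange.Pulled pulled
            (U , k , l , eq₀ , l-cover , k*P₀≤l*Q₀) = initial (z ∘ r) Q₀
        in U , k , r ∘ l , ≈-trans eq₀ assoc , Cover-∘ l-cover r-cover ,
           Chase.pushed-≤ pulled k l eq₀ k*P₀≤l*Q₀ _

    WeaklyInitialMVS-Cov : WeaklyInitialMVS 𝒮 φ₀ a₀ → WeaklyInitialMVS (Cov 𝒮) φ a
    WeaklyInitialMVS-Cov (X' , q₀ , Y , y , P₀ , q₀-cover , y∈𝒮 , initial) =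
      X' , x₀ ∘ q₀ , Y , y , Transport.P q₀ y P₀ , Cover-∘ q₀-cover x₀-cover , 𝒮⊆Cov y∈𝒮 ,
      Transport.transfer q₀ y P₀ initial

  AxiomF-Cov : AxiomF 𝒮 → AxiomF (Cov 𝒮)
  AxiomF-Cov F φ a φ∈Cov a∈Cov = OverCoveredPair.WeaklyInitialMVS-Cov C (F φ₀ a₀ φ₀∈𝒮 a₀∈𝒮)
    where
      C : CoveredBy𝒮 φ a
      C = covered-by-𝒮 φ∈Cov a∈Cov
      open CoveredBy𝒮 C

proposition6p24 : ∀ {o ℓ e s} (𝒞 : Category o ℓ e) (H : PositiveHeyting 𝒞)
    (D : InPH.DisplayMaps 𝒞 H s) →
    InPH.AxiomF 𝒞 H (InPH.DisplayMaps.𝒮 D) →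
    InPH.AxiomF 𝒞 H (InPH.Cov 𝒞 H (InPH.DisplayMaps.𝒮 D))
proposition6p24 𝒞 H D = DisplayLemmas.AxiomF-Cov 𝒞 H D
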